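{- Let $A$ be an abelian group of order $v\equiv 2$ or $4\pmod 6$. The set of $\hat A$-orbits on the $3$-element subsets of $A$ equals $\mathcal T_1\cup\mathcal T_2\cup\mathcal T$, and $\mathcal T\cap(\mathcal T_1\cup\mathcal T_2)=\emptyset$.
   Context: For a finite abelian group $A$ (additive), $\hat A$ is the permutation group on $A$ generated by translations $x\mapsto x+a$ and $x\mapsto -x$; the $\hat A$-orbit of $X$ is $\{X+c\}_{c\in A}\cup\{ -X+c\}_{c\in A}$, and $[a_1,\dots,a_t]$ denotes the $\hat A$-orbit of $\{0,a_1,\dots,a_t\}$. $\Omega_1(A)=\{a: 2a=0\}$. $\mathcal T=\{[a,b]: a,b\in A,\ a\ne\pm b,\ 2a\notin\{0,b,2b\},\ 2b\notin\{0,a,2a\}\}$, $\mathcal T_1=\{[a,-a]: a\in A\setminus\Omega_1(A)\}$, $\mathcal T_2=\{[a,h]: a\in A\setminus\{0\},\ h\in\Omega_1(A)\setminus\{0,a\}\}$. -}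

module Defs where

open import Level using (_⊔_)
open import Algebra.Bundles using (AbelianGroup)
open import Data.Product using (_×_; _,_; ∃; ∃-syntax)
open import Data.Sum using (_⊎_)
open import Relation.Nullary using (¬_)

module Notions {c ℓ} (G : AbelianGroup c ℓ) where
  open AbelianGroup G renaming (_∙_ to _+_; ε to 0#; _⁻¹ to -_)
    using (Carrier; _≈_)

  -- a finite subset with (at most) three listed elements {p, q, r}
  Sub3 : Set c
  Sub3 = Carrier × Carrier × Carrier

  _∈ₛ_ : Carrier → Sub3 → Set ℓ
  x ∈ₛ (p , q , r) = x ≈ p ⊎ x ≈ q ⊎ x ≈ r

  _≐_ : Sub3 → Sub3 → Set (c ⊔ ℓ)
  X ≐ Y = ∀ x → (x ∈ₛ X → x ∈ₛ Y) × (x ∈ₛ Y → x ∈ₛ X)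

  Is3Subset : Sub3 → Set ℓ
  Is3Subset (p , q , r) = ¬ p ≈ q × ¬ p ≈ r × ¬ q ≈ r

  translate : Carrier → Sub3 → Sub3
  translate c (p , q , r) = (p + c , q + c , r + c)

  reflectTranslate : Carrier → Sub3 → Sub3
  reflectTranslate c (p , q , r) = ((- p) + c , (- q) + c , (- r) + c)

  InOrbit : Sub3 → Sub3 → Set (c ⊔ ℓ)
  InOrbit X Y = ∃[ c ] (Y ≐ translate c X ⊎ Y ≐ reflectTranslate c X)

  SameOrbit : Sub3 → Sub3 → Set (c ⊔ ℓ)
  SameOrbit X Y = ∀ Z → (InOrbit X Z → InOrbit Y Z) × (InOrbit Y Z → InOrbit X Z)

  -- representative {0, a, b} of the orbit [a, b]
  ⟦_,_⟧ : Carrier → Carrier → Sub3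
  ⟦ a , b ⟧ = (0# , a , b)

  Ω₁ : Carrier → Set ℓ
  Ω₁ a = a + a ≈ 0#

  CondT : Carrier → Carrier → Set ℓ
  CondT a b = ¬ a ≈ b × ¬ a ≈ - b
            × ¬ (a + a ≈ 0#) × ¬ (a + a ≈ b) × ¬ (a + a ≈ b + b)
            × ¬ (b + b ≈ 0#) × ¬ (b + b ≈ a) × ¬ (b + b ≈ a + a)

  CondT₁ : Carrier → Set ℓ
  CondT₁ a = ¬ Ω₁ a

  CondT₂ : Carrier → Carrier → Set ℓ
  CondT₂ a h = ¬ a ≈ 0# × Ω₁ h × ¬ h ≈ 0# × ¬ h ≈ a

  InT₁ InT₂ InT : Sub3 → Set (c ⊔ ℓ)
  InT₁ X = ∃[ a ] (CondT₁ a × SameOrbit X ⟦ a , - a ⟧)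
  InT₂ X = ∃[ a ] ∃[ h ] (CondT₂ a h × SameOrbit X ⟦ a , h ⟧)
  InT  X = ∃[ a ] ∃[ b ] (CondT a b × SameOrbit X ⟦ a , b ⟧)

  Is3Orbit : Sub3 → Set (c ⊔ ℓ)
  Is3Orbit X = ∃[ Y ] (Is3Subset Y × SameOrbit X Y)

-- The group Â acts on 3-subsets by affine maps x ↦ ±x + c, and every 3-subset is, after
-- translating one of its points to 0, of the form {0, a, b} with a, b, a - b ≠ 0.  Deciding
-- which of the degeneracies a = -b, 2a = 0, 2b = 0, 2a = b, 2b = a, 2a = 2b holds puts the
-- orbit into 𝒯₁ (a = -b, or an arithmetic progression {0, a, 2a} ~ {-a, 0, a}), into 𝒯₂
-- (an involution, or 2a = 2b making a - b an involution), or, if none holds, into 𝒯.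
-- Disjointness: the maps ±x + c preserve the relation s + t = 2u, so "some point u is the
-- midpoint of two points different from u" is an orbit invariant; {0, a, -a} and {0, a, h}
-- (with 0 the midpoint of a, -a and of h, h) have it, and the conditions defining 𝒯 say
-- precisely that {0, a, b} does not.
module Submission where

open import Defs
open import Level using (_⊔_)
open import Algebra.Bundles using (AbelianGroup)
open import Data.Nat using (ℕ; _%_)
open import Data.Fin using (Fin)
import Data.Fin.Properties as Fin
open import Data.Product using (_×_; _,_; ∃-syntax; proj₁; proj₂)
open import Data.Sum using (_⊎_; inj₁; inj₂)
open import Function.Base using (_∘_)
open import Function.Bundles using (Bijection)
open import Function.Definitions using (Congruent; Injective)
open import Relation.Binary.Bundles using (Setoid)
open import Relation.Binary.Definitions using (Decidable)
open import Relation.Binary.PropositionalEquality using (_≡_; setoid)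
open import Relation.Nullary using (¬_; yes; no; contradiction)
open import Relation.Nullary.Decidable using (map′)

module OrbitsOnTriples {c ℓ} (G : AbelianGroup c ℓ) where
  open AbelianGroup G hiding (setoid) renaming (_∙_ to _+_; ε to 0#; _⁻¹ to -_)
  open Notions G
  open import Algebra.Properties.AbelianGroup G
  open import Algebra.Properties.CommutativeSemigroup commutativeSemigroup using (interchange)
  open import Relation.Binary.Reasoning.Setoid (AbelianGroup.setoid G)

  0+0≈0 : 0# + 0# ≈ 0#
  0+0≈0 = identityˡ 0#

  double-0 : ∀ {x} → x ≈ 0# → x + x ≈ 0#
  double-0 x≈0 = trans (∙-cong x≈0 x≈0) 0+0≈0

  -x≈0⇒x≈0 : ∀ {x} → - x ≈ 0# → x ≈ 0#
  -x≈0⇒x≈0 {x} -x≈0 = trans (sym (⁻¹-involutive x)) (trans (⁻¹-cong -x≈0) ε⁻¹≈ε)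

  x≈-x⇒double-0 : ∀ {x} → x ≈ - x → x + x ≈ 0#
  x≈-x⇒double-0 {x} x≈-x = trans (∙-congˡ x≈-x) (inverseʳ x)

  double-0⇒x≈-x : ∀ {x} → x + x ≈ 0# → x ≈ - x
  double-0⇒x≈-x {x} = inverseˡ-unique x x

  x+c-c≈x : ∀ c x → (x + c) + - c ≈ x
  x+c-c≈x c x = trans (assoc x c (- c)) (trans (∙-congˡ (inverseʳ c)) (identityʳ x))

  sum-0+0⇒≈- : ∀ {x y} → x + y ≈ 0# + 0# → x ≈ - y
  sum-0+0⇒≈- {x} {y} e = inverseˡ-unique x y (trans e 0+0≈0)

  translate-midpoint : ∀ d {s t u} → s + t ≈ u + u → (s + d) + (t + d) ≈ (u + d) + (u + d)
  translate-midpoint d {s} {t} {u} e = begin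
    (s + d) + (t + d) ≈⟨ interchange s d t d ⟩
    (s + t) + (d + d) ≈⟨ ∙-congʳ e ⟩
    (u + u) + (d + d) ≈⟨ interchange u u d d ⟩
    (u + d) + (u + d) ∎

  reflect-sum : ∀ d x y → (- x + d) + (- y + d) ≈ - (x + y) + (d + d)
  reflect-sum d x y = trans (interchange (- x) d (- y) d) (∙-congʳ (⁻¹-∙-comm x y))

  reflect-midpoint : ∀ d {s t u} → s + t ≈ u + u → (- s + d) + (- t + d) ≈ (- u + d) + (- u + d)
  reflect-midpoint d {s} {t} {u} e = begin
    (- s + d) + (- t + d) ≈⟨ reflect-sum d s t ⟩
    - (s + t) + (d + d)   ≈⟨ ∙-congʳ (⁻¹-cong e) ⟩
    - (u + u) + (d + d)   ≈⟨ reflect-sum d u u ⟨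
    (- u + d) + (- u + d) ∎

  -- translate c and reflectTranslate c are definitionally mapS (_+ c) and mapS (λ x → - x + c).
  mapS : (Carrier → Carrier) → Sub3 → Sub3
  mapS f (p , q , r) = (f p , f q , f r)

  ∈-resp-≈ : ∀ {x y} X → x ≈ y → y ∈ₛ X → x ∈ₛ X
  ∈-resp-≈ X x≈y (inj₁ e)        = inj₁ (trans x≈y e)
  ∈-resp-≈ X x≈y (inj₂ (inj₁ e)) = inj₂ (inj₁ (trans x≈y e))
  ∈-resp-≈ X x≈y (inj₂ (inj₂ e)) = inj₂ (inj₂ (trans x≈y e))

  ∈-mapS : ∀ {f} → Congruent _≈_ _≈_ f → ∀ {x} X → x ∈ₛ X → f x ∈ₛ mapS f X
  ∈-mapS f-cong X (inj₁ e)        = inj₁ (f-cong e)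
  ∈-mapS f-cong X (inj₂ (inj₁ e)) = inj₂ (inj₁ (f-cong e))
  ∈-mapS f-cong X (inj₂ (inj₂ e)) = inj₂ (inj₂ (f-cong e))

  ∈-mapS⁻ : ∀ {f y} X → y ∈ₛ mapS f X → ∃[ x ] (x ∈ₛ X × y ≈ f x)
  ∈-mapS⁻ X (inj₁ e)        = _ , inj₁ refl , e
  ∈-mapS⁻ X (inj₂ (inj₁ e)) = _ , inj₂ (inj₁ refl) , e
  ∈-mapS⁻ X (inj₂ (inj₂ e)) = _ , inj₂ (inj₂ refl) , e

  ≐-refl : ∀ {X} → X ≐ X
  ≐-refl x = (λ x∈ → x∈) , (λ x∈ → x∈)

  ≐-sym : ∀ {X Y} → X ≐ Y → Y ≐ X
  ≐-sym X≐Y x = proj₂ (X≐Y x) , proj₁ (X≐Y x)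

  ≐-trans : ∀ {X Y Z} → X ≐ Y → Y ≐ Z → X ≐ Z
  ≐-trans X≐Y Y≐Z x = proj₁ (Y≐Z x) ∘ proj₁ (X≐Y x) , proj₂ (X≐Y x) ∘ proj₂ (Y≐Z x)

  ⊆-mapS : ∀ {f} → Congruent _≈_ _≈_ f → ∀ {X Y} → X ≐ Y
         → ∀ y → y ∈ₛ mapS f X → y ∈ₛ mapS f Y
  ⊆-mapS f-cong {X} {Y} X≐Y y y∈fX with ∈-mapS⁻ X y∈fX
  ... | x , x∈X , y≈fx = ∈-resp-≈ _ y≈fx (∈-mapS f-cong Y (proj₁ (X≐Y x) x∈X))

  mapS-resp-≐ : ∀ {f} → Congruent _≈_ _≈_ f → ∀ {X Y} → X ≐ Y → mapS f X ≐ mapS f Y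
  mapS-resp-≐ f-cong X≐Y y = ⊆-mapS f-cong X≐Y y , ⊆-mapS f-cong (≐-sym X≐Y) y

  _≋_ : Sub3 → Sub3 → Set ℓ
  (p , q , r) ≋ (p′ , q′ , r′) = p ≈ p′ × q ≈ q′ × r ≈ r′

  ≋⇒≐ : ∀ {X Y} → X ≋ Y → X ≐ Y
  ≋⇒≐ (p≈ , q≈ , r≈) x =
    (λ { (inj₁ e)        → inj₁ (trans e p≈)
       ; (inj₂ (inj₁ e)) → inj₂ (inj₁ (trans e q≈))
       ; (inj₂ (inj₂ e)) → inj₂ (inj₂ (trans e r≈)) }) ,
    (λ { (inj₁ e)        → inj₁ (trans e (sym p≈))
       ; (inj₂ (inj₁ e)) → inj₂ (inj₁ (trans e (sym q≈)))
       ; (inj₂ (inj₂ e)) → inj₂ (inj₂ (trans e (sym r≈))) })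

  mapS-cong : ∀ {f g} → (∀ x → f x ≈ g x) → ∀ X → mapS f X ≐ mapS g X
  mapS-cong f≈g (p , q , r) = ≋⇒≐ (f≈g p , f≈g q , f≈g r)

  swap₁₂ : ∀ {p q r} → (p , q , r) ≐ (q , p , r)
  swap₁₂ x = swap , swap
    where
    swap : ∀ {p q r} → x ∈ₛ (p , q , r) → x ∈ₛ (q , p , r)
    swap (inj₁ e)        = inj₂ (inj₁ e)
    swap (inj₂ (inj₁ e)) = inj₁ e
    swap (inj₂ (inj₂ e)) = inj₂ (inj₂ e)

  swap₂₃ : ∀ {p q r} → (p , q , r) ≐ (p , r , q)
  swap₂₃ x = swap , swap
    where
    swap : ∀ {p q r} → x ∈ₛ (p , q , r) → x ∈ₛ (p , r , q)
    swap (inj₁ e)        = inj₁ e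
    swap (inj₂ (inj₁ e)) = inj₂ (inj₂ e)
    swap (inj₂ (inj₂ e)) = inj₂ (inj₁ e)

  ∈-others : ∀ {x p q r} → x ∈ₛ (p , q , r) → ¬ x ≈ p → x ≈ q ⊎ x ≈ r
  ∈-others (inj₁ x≈p) x≉p = contradiction x≈p x≉p
  ∈-others (inj₂ x∈qr) x≉p = x∈qr

  translate-cong : ∀ d {X Y} → X ≐ Y → translate d X ≐ translate d Y
  translate-cong d = mapS-resp-≐ ∙-congʳ

  reflectTranslate-cong : ∀ d {X Y} → X ≐ Y → reflectTranslate d X ≐ reflectTranslate d Y
  reflectTranslate-cong d = mapS-resp-≐ (∙-congʳ ∘ ⁻¹-cong)

  translate-translate : ∀ c d X → translate d (translate c X) ≐ translate (c + d) X
  translate-translate c d = mapS-cong (λ x → assoc x c d)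

  translate-reflectTranslate : ∀ c d X
    → translate d (reflectTranslate c X) ≐ reflectTranslate (c + d) X
  translate-reflectTranslate c d = mapS-cong (λ x → assoc (- x) c d)

  -[x+c]+d≈-x+[d-c] : ∀ c d x → - (x + c) + d ≈ - x + (d + - c)
  -[x+c]+d≈-x+[d-c] c d x = begin
    - (x + c) + d   ≈⟨ ∙-congʳ (⁻¹-∙-comm x c) ⟨
    (- x + - c) + d ≈⟨ assoc (- x) (- c) d ⟩
    - x + (- c + d) ≈⟨ ∙-congˡ (comm (- c) d) ⟩
    - x + (d + - c) ∎

  reflectTranslate-translate : ∀ c d X
    → reflectTranslate d (translate c X) ≐ reflectTranslate (d + - c) X
  reflectTranslate-translate c d = mapS-cong (-[x+c]+d≈-x+[d-c] c d)

  -[-x+c]+d≈x+[d-c] : ∀ c d x → - (- x + c) + d ≈ x + (d + - c)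
  -[-x+c]+d≈x+[d-c] c d x = trans (-[x+c]+d≈-x+[d-c] c d (- x)) (∙-congʳ (⁻¹-involutive x))

  reflectTranslate-reflectTranslate : ∀ c d X
    → reflectTranslate d (reflectTranslate c X) ≐ translate (d + - c) X
  reflectTranslate-reflectTranslate c d = mapS-cong (-[-x+c]+d≈x+[d-c] c d)

  translate-identity : ∀ X → translate 0# X ≐ X
  translate-identity = mapS-cong identityʳ

  translate-inverse : ∀ c X → translate (- c) (translate c X) ≐ X
  translate-inverse c = mapS-cong (x+c-c≈x c)

  reflectTranslate-involutive : ∀ c X → reflectTranslate c (reflectTranslate c X) ≐ X
  reflectTranslate-involutive c =
    mapS-cong (λ x → trans (-[-x+c]+d≈x+[d-c] c c x) (trans (sym (assoc x c (- c))) (x+c-c≈x c x)))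

  ≐⇒InOrbit : ∀ {X Y} → X ≐ Y → InOrbit X Y
  ≐⇒InOrbit {X} X≐Y = 0# , inj₁ (≐-trans (≐-sym X≐Y) (≐-sym (translate-identity X)))

  InOrbit-refl : ∀ X → InOrbit X X
  InOrbit-refl X = ≐⇒InOrbit ≐-refl

  InOrbit-trans : ∀ {X Y Z} → InOrbit X Y → InOrbit Y Z → InOrbit X Z
  InOrbit-trans {X} (c , inj₁ Y≐) (d , inj₁ Z≐) =
    c + d , inj₁ (≐-trans Z≐ (≐-trans (translate-cong d Y≐) (translate-translate c d X)))
  InOrbit-trans {X} (c , inj₂ Y≐) (d , inj₁ Z≐) =
    c + d , inj₂ (≐-trans Z≐ (≐-trans (translate-cong d Y≐) (translate-reflectTranslate c d X)))
  InOrbit-trans {X} (c , inj₁ Y≐) (d , inj₂ Z≐) =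
    d + - c , inj₂ (≐-trans Z≐
      (≐-trans (reflectTranslate-cong d Y≐) (reflectTranslate-translate c d X)))
  InOrbit-trans {X} (c , inj₂ Y≐) (d , inj₂ Z≐) =
    d + - c , inj₁ (≐-trans Z≐
      (≐-trans (reflectTranslate-cong d Y≐) (reflectTranslate-reflectTranslate c d X)))

  InOrbit-sym : ∀ {X Y} → InOrbit X Y → InOrbit Y X
  InOrbit-sym {X} (c , inj₁ Y≐) =
    - c , inj₁ (≐-sym (≐-trans (translate-cong (- c) Y≐) (translate-inverse c X)))
  InOrbit-sym {X} (c , inj₂ Y≐) =
    c , inj₂ (≐-sym (≐-trans (reflectTranslate-cong c Y≐) (reflectTranslate-involutive c X)))

  InOrbit⇒SameOrbit : ∀ {X Y} → InOrbit X Y → SameOrbit X Y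
  InOrbit⇒SameOrbit X~Y Z = InOrbit-trans (InOrbit-sym X~Y) , InOrbit-trans X~Y

  SameOrbit⇒InOrbit : ∀ {X Y} → SameOrbit X Y → InOrbit Y X
  SameOrbit⇒InOrbit {X} X≈Y = proj₁ (X≈Y X) (InOrbit-refl X)

  SameOrbit-refl : ∀ {X} → SameOrbit X X
  SameOrbit-refl Z = (λ z → z) , (λ z → z)

  SameOrbit-trans : ∀ {X Y Z} → SameOrbit X Y → SameOrbit Y Z → SameOrbit X Z
  SameOrbit-trans X≈Y Y≈Z W =
    proj₁ (Y≈Z W) ∘ proj₁ (X≈Y W) , proj₂ (X≈Y W) ∘ proj₂ (Y≈Z W)

  ≐⇒SameOrbit : ∀ {X Y} → X ≐ Y → SameOrbit X Y
  ≐⇒SameOrbit = InOrbit⇒SameOrbit ∘ ≐⇒InOrbit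

  HasMidpoint : Sub3 → Set (c ⊔ ℓ)
  HasMidpoint X = ∃[ s ] ∃[ t ] ∃[ u ]
    (s ∈ₛ X × t ∈ₛ X × u ∈ₛ X × ¬ s ≈ u × ¬ t ≈ u × s + t ≈ u + u)

  HasMidpoint-resp-≐ : ∀ {X Y} → X ≐ Y → HasMidpoint X → HasMidpoint Y
  HasMidpoint-resp-≐ X≐Y (s , t , u , s∈ , t∈ , u∈ , s≉u , t≉u , mid) =
    s , t , u , proj₁ (X≐Y s) s∈ , proj₁ (X≐Y t) t∈ , proj₁ (X≐Y u) u∈ , s≉u , t≉u , mid

  HasMidpoint-mapS : ∀ {f} → Congruent _≈_ _≈_ f → Injective _≈_ _≈_ f
    → (∀ {s t u} → s + t ≈ u + u → f s + f t ≈ f u + f u)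
    → ∀ X → HasMidpoint X → HasMidpoint (mapS f X)
  HasMidpoint-mapS {f} f-cong f-inj f-mid X (s , t , u , s∈ , t∈ , u∈ , s≉u , t≉u , mid) =
    f s , f t , f u , ∈-mapS f-cong X s∈ , ∈-mapS f-cong X t∈ , ∈-mapS f-cong X u∈ ,
    s≉u ∘ f-inj , t≉u ∘ f-inj , f-mid mid

  HasMidpoint-InOrbit : ∀ {X Y} → InOrbit X Y → HasMidpoint X → HasMidpoint Y
  HasMidpoint-InOrbit {X} (d , inj₁ Y≐) =
    HasMidpoint-resp-≐ (≐-sym Y≐) ∘
    HasMidpoint-mapS ∙-congʳ (∙-cancelʳ d _ _) (translate-midpoint d) X
  HasMidpoint-InOrbit {X} (d , inj₂ Y≐) =
    HasMidpoint-resp-≐ (≐-sym Y≐) ∘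
    HasMidpoint-mapS (∙-congʳ ∘ ⁻¹-cong) (⁻¹-injective ∘ ∙-cancelʳ d _ _) (reflect-midpoint d) X

  HasMidpoint-⟦a,-a⟧ : ∀ {a} → CondT₁ a → HasMidpoint ⟦ a , - a ⟧
  HasMidpoint-⟦a,-a⟧ {a} ¬2a≈0 =
    a , - a , 0# , inj₂ (inj₁ refl) , inj₂ (inj₂ refl) , inj₁ refl ,
    ¬2a≈0 ∘ double-0 , ¬2a≈0 ∘ double-0 ∘ -x≈0⇒x≈0 , trans (inverseʳ a) (sym 0+0≈0)

  HasMidpoint-⟦a,h⟧ : ∀ {a h} → CondT₂ a h → HasMidpoint ⟦ a , h ⟧
  HasMidpoint-⟦a,h⟧ (_ , 2h≈0 , h≉0 , _) =
    _ , _ , 0# , inj₂ (inj₂ refl) , inj₂ (inj₂ refl) , inj₁ refl ,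
    h≉0 , h≉0 , trans 2h≈0 (sym 0+0≈0)

  no-midpoint-at : ∀ {w p q s t}
    → ¬ p + p ≈ w + w → ¬ p + q ≈ w + w → ¬ q + q ≈ w + w
    → s ∈ₛ (w , p , q) → t ∈ₛ (w , p , q) → ¬ (¬ s ≈ w × ¬ t ≈ w × s + t ≈ w + w)
  no-midpoint-at ¬2p ¬p+q ¬2q s∈ t∈ (s≉w , t≉w , s+t≈2w)
    with ∈-others s∈ s≉w | ∈-others t∈ t≉w
  ... | inj₁ s≈p | inj₁ t≈p = ¬2p (trans (∙-cong (sym s≈p) (sym t≈p)) s+t≈2w)
  ... | inj₁ s≈p | inj₂ t≈q = ¬p+q (trans (∙-cong (sym s≈p) (sym t≈q)) s+t≈2w)
  ... | inj₂ s≈q | inj₁ t≈p = ¬p+q (trans (comm _ _) (trans (∙-cong (sym s≈q) (sym t≈p)) s+t≈2w))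
  ... | inj₂ s≈q | inj₂ t≈q = ¬2q (trans (∙-cong (sym s≈q) (sym t≈q)) s+t≈2w)

  ¬HasMidpoint-⟦a,b⟧ : ∀ {a b} → CondT a b → ¬ HasMidpoint ⟦ a , b ⟧
  ¬HasMidpoint-⟦a,b⟧ {a} {b} (_ , a≉-b , ¬2a≈0 , ¬2a≈b , ¬2a≈2b , ¬2b≈0 , ¬2b≈a , ¬2b≈2a)
                              (s , t , u , s∈ , t∈ , u∈ , s≉u , t≉u , s+t≈2u) = midpoint-excluded u∈
    where
    midpoint-at : ∀ {w} → u ≈ w → ¬ s ≈ w × ¬ t ≈ w × s + t ≈ w + w
    midpoint-at u≈w =
      s≉u ∘ (λ s≈w → trans s≈w (sym u≈w)) , t≉u ∘ (λ t≈w → trans t≈w (sym u≈w)) ,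
      trans s+t≈2u (∙-cong u≈w u≈w)

    ≉0+0 : ∀ {x} → ¬ x ≈ 0# → ¬ x ≈ 0# + 0#
    ≉0+0 x≉0 x≈0+0 = x≉0 (trans x≈0+0 0+0≈0)

    ≉0+x : ∀ {x y} → ¬ y ≈ x → ¬ 0# + x ≈ y
    ≉0+x {x} y≉x 0+x≈y = y≉x (trans (sym 0+x≈y) (identityˡ x))

    midpoint-excluded : ¬ u ∈ₛ ⟦ a , b ⟧
    midpoint-excluded (inj₁ u≈0) =
      no-midpoint-at (≉0+0 ¬2a≈0) (a≉-b ∘ sum-0+0⇒≈-) (≉0+0 ¬2b≈0) s∈ t∈ (midpoint-at u≈0)
    midpoint-excluded (inj₂ (inj₁ u≈a)) =
      no-midpoint-at (≉0+0 ¬2a≈0 ∘ sym) (≉0+x ¬2a≈b) ¬2b≈2a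
        (proj₁ (swap₁₂ s) s∈) (proj₁ (swap₁₂ t) t∈) (midpoint-at u≈a)
    midpoint-excluded (inj₂ (inj₂ u≈b)) =
      no-midpoint-at (≉0+0 ¬2b≈0 ∘ sym) (≉0+x ¬2b≈a) ¬2a≈2b
        (proj₁ (swap₁₂ s) (proj₁ (swap₂₃ s) s∈)) (proj₁ (swap₁₂ t) (proj₁ (swap₂₃ t) t∈))
        (midpoint-at u≈b)

  CondT⇒¬InT₁×¬InT₂ : ∀ {a b} → CondT a b → ¬ InT₁ ⟦ a , b ⟧ × ¬ InT₂ ⟦ a , b ⟧
  CondT⇒¬InT₁×¬InT₂ ab∈𝒯 =
    (λ (_ , cond , same) → ¬HasMidpoint-⟦a,b⟧ ab∈𝒯
       (HasMidpoint-InOrbit (SameOrbit⇒InOrbit same) (HasMidpoint-⟦a,-a⟧ cond))) ,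
    (λ (_ , _ , cond , same) → ¬HasMidpoint-⟦a,b⟧ ab∈𝒯
       (HasMidpoint-InOrbit (SameOrbit⇒InOrbit same) (HasMidpoint-⟦a,h⟧ cond)))

  Is3Subset⇒Is3Orbit : ∀ {X} → Is3Subset X → Is3Orbit X
  Is3Subset⇒Is3Orbit {X} X-3 = X , X-3 , SameOrbit-refl

  CondT₁⇒Is3Subset : ∀ {a} → CondT₁ a → Is3Subset ⟦ a , - a ⟧
  CondT₁⇒Is3Subset ¬2a≈0 =
    ¬2a≈0 ∘ double-0 ∘ sym , ¬2a≈0 ∘ double-0 ∘ -x≈0⇒x≈0 ∘ sym , ¬2a≈0 ∘ x≈-x⇒double-0

  CondT₂⇒Is3Subset : ∀ {a h} → CondT₂ a h → Is3Subset ⟦ a , h ⟧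
  CondT₂⇒Is3Subset (a≉0 , _ , h≉0 , h≉a) = a≉0 ∘ sym , h≉0 ∘ sym , h≉a ∘ sym

  CondT⇒Is3Subset : ∀ {a b} → CondT a b → Is3Subset ⟦ a , b ⟧
  CondT⇒Is3Subset (a≉b , _ , ¬2a≈0 , _ , _ , ¬2b≈0 , _ , _) =
    ¬2a≈0 ∘ double-0 ∘ sym , ¬2b≈0 ∘ double-0 ∘ sym , a≉b

  Classified : Sub3 → Set (c ⊔ ℓ)
  Classified X = InT₁ X ⊎ InT₂ X ⊎ InT X

  Classified-resp-SameOrbit : ∀ {X Y} → SameOrbit X Y → Classified Y → Classified X
  Classified-resp-SameOrbit X≈Y (inj₁ (a , cond , same)) =
    inj₁ (a , cond , SameOrbit-trans X≈Y same)
  Classified-resp-SameOrbit X≈Y (inj₂ (inj₁ (a , h , cond , same))) =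
    inj₂ (inj₁ (a , h , cond , SameOrbit-trans X≈Y same))
  Classified-resp-SameOrbit X≈Y (inj₂ (inj₂ (a , b , cond , same))) =
    inj₂ (inj₂ (a , b , cond , SameOrbit-trans X≈Y same))

  SameOrbit-⟦q-p,r-p⟧ : ∀ {p q r} → SameOrbit (p , q , r) ⟦ q + - p , r + - p ⟧
  SameOrbit-⟦q-p,r-p⟧ {p} =
    InOrbit⇒SameOrbit (- p , inj₁ (≋⇒≐ (sym (inverseʳ p) , refl , refl)))

  InT₁-opposite : ∀ {a b} → a ≈ - b → ¬ a ≈ b → InT₁ ⟦ a , b ⟧
  InT₁-opposite {a} {b} a≈-b a≉b =
    b , a≉b ∘ trans a≈-b ∘ sym ∘ double-0⇒x≈-x ,
    ≐⇒SameOrbit (≐-trans swap₂₃ (≋⇒≐ (refl , refl , a≈-b)))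

  -- {0, a, 2a} is the translate of {-a, 0, a} by a.
  InT₁-progression : ∀ {a b} → a + a ≈ b → ¬ b ≈ 0# → InT₁ ⟦ a , b ⟧
  InT₁-progression {a} {b} 2a≈b b≉0 =
    a , b≉0 ∘ trans (sym 2a≈b) ,
    InOrbit⇒SameOrbit (- a , inj₁ (≐-trans swap₂₃ (≐-trans swap₁₂
      (≋⇒≐ (sym (identityˡ (- a)) , sym (inverseʳ a) , sym 2a-a≈a)))))
    where
    2a-a≈a : b + - a ≈ a
    2a-a≈a = trans (∙-congʳ (sym 2a≈b)) (x+c-c≈x a a)

  -- If 2a = 2b then a - b is an involution, and {0, a, b} - b = {-b, a - b, 0}.
  InT₂-equal-doubles : ∀ {a b} → ¬ a ≈ 0# → ¬ b ≈ 0# → ¬ a ≈ b → a + a ≈ b + b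
                     → InT₂ ⟦ a , b ⟧
  InT₂-equal-doubles {a} {b} a≉0 b≉0 a≉b 2a≈2b =
    - b , a + - b , (b≉0 ∘ -x≈0⇒x≈0 , 2[a-b]≈0 , a≉b ∘ x∙y⁻¹≈ε⇒x≈y a b , a-b≉-b) ,
    InOrbit⇒SameOrbit (- b , inj₁ (≐-trans swap₁₂ (≐-trans swap₂₃
      (≋⇒≐ (sym (identityˡ (- b)) , refl , sym (inverseʳ b))))))
    where
    2[a-b]≈0 : (a + - b) + (a + - b) ≈ 0#
    2[a-b]≈0 = begin
      (a + - b) + (a + - b) ≈⟨ interchange a (- b) a (- b) ⟩
      (a + a) + (- b + - b) ≈⟨ ∙-congʳ 2a≈2b ⟩
      (b + b) + (- b + - b) ≈⟨ interchange b b (- b) (- b) ⟩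
      (b + - b) + (b + - b) ≈⟨ ∙-cong (inverseʳ b) (inverseʳ b) ⟩
      0# + 0#               ≈⟨ 0+0≈0 ⟩
      0#                    ∎

    a-b≉-b : ¬ a + - b ≈ - b
    a-b≉-b a-b≈-b = a≉0 (∙-cancelʳ (- b) a 0# (trans a-b≈-b (sym (identityˡ (- b)))))

  module _ (_≟_ : Decidable _≈_) where

    Classified-⟦a,b⟧ : ∀ {a b} → ¬ a ≈ 0# → ¬ b ≈ 0# → ¬ a ≈ b → Classified ⟦ a , b ⟧
    Classified-⟦a,b⟧ {a} {b} a≉0 b≉0 a≉b with a ≟ (- b)
    ... | yes a≈-b = inj₁ (InT₁-opposite a≈-b a≉b)
    ... | no a≉-b with (a + a) ≟ 0#
    ... | yes 2a≈0 = inj₂ (inj₁ (b , a , (b≉0 , 2a≈0 , a≉0 , a≉b) , ≐⇒SameOrbit swap₂₃))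
    ... | no ¬2a≈0 with (b + b) ≟ 0#
    ... | yes 2b≈0 = inj₂ (inj₁ (a , b , (a≉0 , 2b≈0 , b≉0 , a≉b ∘ sym) , SameOrbit-refl))
    ... | no ¬2b≈0 with (a + a) ≟ b
    ... | yes 2a≈b = inj₁ (InT₁-progression 2a≈b b≉0)
    ... | no ¬2a≈b with (b + b) ≟ a
    ... | yes 2b≈a =
      Classified-resp-SameOrbit (≐⇒SameOrbit swap₂₃) (inj₁ (InT₁-progression 2b≈a a≉0))
    ... | no ¬2b≈a with (a + a) ≟ (b + b)
    ... | yes 2a≈2b = inj₂ (inj₁ (InT₂-equal-doubles a≉0 b≉0 a≉b 2a≈2b))
    ... | no ¬2a≈2b =
      inj₂ (inj₂ (a , b , (a≉b , a≉-b , ¬2a≈0 , ¬2a≈b , ¬2a≈2b , ¬2b≈0 , ¬2b≈a , ¬2a≈2b ∘ sym) ,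
                  SameOrbit-refl))

    Is3Subset⇒Classified : ∀ X → Is3Subset X → Classified X
    Is3Subset⇒Classified (p , q , r) (p≉q , p≉r , q≉r) =
      Classified-resp-SameOrbit SameOrbit-⟦q-p,r-p⟧
        (Classified-⟦a,b⟧ (p≉q ∘ sym ∘ x∙y⁻¹≈ε⇒x≈y q p) (p≉r ∘ sym ∘ x∙y⁻¹≈ε⇒x≈y r p)
                          (q≉r ∘ ∙-cancelʳ (- p) q r))

module _ {a ℓ₁ b ℓ₂} {S : Setoid a ℓ₁} {T : Setoid b ℓ₂} (f : Bijection S T) where
  open Bijection f
  private
    module S = Setoid S
    module T = Setoid T

  ≈-decidable-via-bijection : Decidable S._≈_ → Decidable T._≈_
  ≈-decidable-via-bijection _≟_ x y with surjective x | surjective y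
  ... | i , to-i≈x | j , to-j≈y =
    map′ (λ i≈j → T.trans (T.sym (to-i≈x S.refl)) (to-j≈y i≈j))
         (λ x≈y → injective (T.trans (to-i≈x S.refl) (T.trans x≈y (T.sym (to-j≈y S.refl)))))
         (i ≟ j)

lemma4p1 : ∀ {c ℓ} (G : AbelianGroup c ℓ) (v : ℕ)
    → Bijection (setoid (Fin v)) (AbelianGroup.setoid G)
    → (v % 6 ≡ 2 ⊎ v % 6 ≡ 4)
    → let open AbelianGroup G renaming (_⁻¹ to -_) using () in
      let open Notions G in
      -- every orbit on 3-subsets lies in 𝒯₁ ∪ 𝒯₂ ∪ 𝒯
      (∀ X → Is3Subset X → InT₁ X ⊎ InT₂ X ⊎ InT X)
      -- every member of 𝒯₁ ∪ 𝒯₂ ∪ 𝒯 is an orbit on 3-subsets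
      × (∀ a → CondT₁ a → Is3Orbit ⟦ a , - a ⟧)
      × (∀ a h → CondT₂ a h → Is3Orbit ⟦ a , h ⟧)
      × (∀ a b → CondT a b → Is3Orbit ⟦ a , b ⟧)
      -- 𝒯 ∩ (𝒯₁ ∪ 𝒯₂) = ∅
      × (∀ a b → CondT a b → ¬ InT₁ ⟦ a , b ⟧ × ¬ InT₂ ⟦ a , b ⟧)
lemma4p1 G v Fin↔G _ =
  Is3Subset⇒Classified (≈-decidable-via-bijection Fin↔G Fin._≟_) ,
  (λ _ → Is3Subset⇒Is3Orbit ∘ CondT₁⇒Is3Subset) ,
  (λ _ _ → Is3Subset⇒Is3Orbit ∘ CondT₂⇒Is3Subset) ,
  (λ _ _ → Is3Subset⇒Is3Orbit ∘ CondT⇒Is3Subset) ,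
  (λ _ _ → CondT⇒¬InT₁×¬InT₂)
  where open OrbitsOnTriples G
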